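{- Let $K$ be a finite CW complex of dimension $k\ge1$. Then its Bott polynomial satisfies $$R_K(\lambda)=(-1)^{\beta_k(K)}\,T^k_K(-1,-\lambda).$$
   Context: $\mathcal S_k$ is the set of subcomplexes $S$ with $K_{(k-1)}\subseteq S\subseteq K$ ($K_{(k-1)}$ the $(k-1)$-skeleton); $f_k(S)$ is the number of $k$-cells of $S$; $\beta_i(S)$ is the rank of $H_i(S;\mathbb Z)$. The Bott polynomial is $R_K(\lambda)=\sum_{S\in\mathcal S_k}(-1)^{f_k(K)-f_k(S)}\lambda^{\beta_k(S)}$, and the Tutte-Krushkal-Renardy polynomial is $T^k_K(X,Y)=\sum_{S\in\mathcal S_k}X^{\beta_{k-1}(S)-\beta_{k-1}(K)}Y^{\beta_k(S)}$. -}

module Defs where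

open import Data.Nat using (ℕ; zero; suc; _≤_; _<_; _∸_; _≟_)
open import Data.Integer using (ℤ; 0ℤ; 1ℤ; _+_; _*_; -_; _^_)
open import Data.Fin using (Fin; zero; suc)
open import Data.Fin.Subset using (Subset; _∉_; ⊤; ∣_∣)
open import Data.Vec using ([]; _∷_)
open import Data.Bool using (true; false)
open import Data.List using (List; []; _∷_; map; _++_; foldr)
open import Data.Product using (Σ; _×_)
open import Relation.Binary.PropositionalEquality using (_≡_; sym; subst)
open import Relation.Nullary using (yes; no)

sumFin : ∀ {n} → (Fin n → ℤ) → ℤ
sumFin {zero}  f = 0ℤ
sumFin {suc n} f = f zero + sumFin (λ i → f (suc i))

sumList : List ℤ → ℤ
sumList = foldr _+_ 0ℤ

allSubsets : (n : ℕ) → List (Subset n)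
allSubsets zero    = [] ∷ []
allSubsets (suc n) = map (true ∷_) (allSubsets n) ++ map (false ∷_) (allSubsets n)

-- A finite CW complex, represented by its cellular chain complex:
-- cells i = number of i-cells, C_i = ℤ^(cells i) with the cells as basis,
-- bd i = integer matrix of the cellular boundary ∂_{i+1} : C_{i+1} → C_i
-- (∂_0 = 0).  dim is the dimension: there is a dim-cell and none above.
record CWComplex : Set where
  field
    dim   : ℕ
    cells : ℕ → ℕ
    bd    : (i : ℕ) → Fin (cells i) → Fin (cells (suc i)) → ℤ
    bd∘bd : ∀ i (a : Fin (cells i)) (c : Fin (cells (suc (suc i)))) →
            sumFin (λ b → bd i a b * bd (suc i) b c) ≡ 0ℤ
    top   : 1 ≤ cells dim
    above : ∀ i → dim < i → cells i ≡ 0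

module _ (K : CWComplex) where
  open CWComplex K

  Chain : ℕ → Set
  Chain i = Fin (cells i) → ℤ

  ∂ : (i : ℕ) → Chain (suc i) → Chain i
  ∂ i c a = sumFin (λ b → bd i a b * c b)

  -- A subcomplex S ∈ 𝒮_k (k = dim) is the full (k-1)-skeleton together with
  -- a set S of k-cells; cellsOf S i is the set of i-cells of that subcomplex.
  cellsOf : Subset (cells dim) → (i : ℕ) → Subset (cells i)
  cellsOf S i with i ≟ dim
  ... | yes i≡k = subst (λ j → Subset (cells j)) (sym i≡k) S
  ... | no  _   = ⊤

  InSub : Subset (cells dim) → (i : ℕ) → Chain i → Set
  InSub S i c = ∀ j → j ∉ cellsOf S i → c j ≡ 0ℤ

  IsCycle : Subset (cells dim) → (i : ℕ) → Chain i → Set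
  IsCycle S zero    z = InSub S zero z
  IsCycle S (suc i) z = InSub S (suc i) z × (∀ a → ∂ i z a ≡ 0ℤ)

  IsBoundary : Subset (cells dim) → (i : ℕ) → Chain i → Set
  IsBoundary S i x = Σ (Chain (suc i)) λ c → InSub S (suc i) c × (∀ a → ∂ i c a ≡ x a)

  combo : ∀ {i r} → (Fin r → ℤ) → (Fin r → Chain i) → Chain i
  combo a z j = sumFin (λ t → a t * z t j)

  IndepInHomology : (S : Subset (cells dim)) (i : ℕ) {r : ℕ} → (Fin r → Chain i) → Set
  IndepInHomology S i {r} z =
    (∀ t → IsCycle S i (z t)) ×
    (∀ (a : Fin r → ℤ) → IsBoundary S i (combo a z) → ∀ t → a t ≡ 0ℤ)

  IsBetti : Subset (cells dim) → ℕ → ℕ → Set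
  IsBetti S i b =
    Σ (Fin b → Chain i) (IndepInHomology S i) ×
    (∀ r (z : Fin r → Chain i) → IndepInHomology S i z → r ≤ b)

  Bott : (Subset (cells dim) → ℕ) → ℤ → ℤ
  Bott βk λ' = sumList (map (λ S → ((- 1ℤ) ^ (cells dim ∸ ∣ S ∣)) * (λ' ^ βk S))
                            (allSubsets (cells dim)))

  TKR : (Subset (cells dim) → ℕ) → (Subset (cells dim) → ℕ) → ℤ → ℤ → ℤ
  TKR βk βk-1 X Y = sumList (map (λ S → (X ^ (βk-1 S ∸ βk-1 ⊤)) * (Y ^ βk S))
                                 (allSubsets (cells dim)))

module Submission where

-- Comparing the summands indexed by S ∈ 𝒮_k, the identity reduces to the parity relation
--   β_k(K) + (β_{k-1}(S) − β_{k-1}(K)) = β_k(S) + (f_k(K) − f_k(S)).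
-- It follows from an exchange property: adding a k-cell e to S either raises β_k by one and
-- keeps β_{k-1} (when some nonzero multiple of ∂e already bounds in S), or keeps β_k and
-- lowers β_{k-1} by one.  Climbing from S to K one cell at a time gives the relation.
--
-- Betti numbers are given as sizes of maximal independent families of homology classes, so
-- all comparisons are made by transporting, extending and shrinking independent families.

open import Defs
open import Data.Nat as ℕ using (ℕ; zero; suc; _≤_; _<_; _∸_; _≟_; z≤n; s≤s)
import Data.Nat.Properties as ℕₚ
open import Data.Integer using (ℤ; 0ℤ; 1ℤ; _+_; _*_; -_; _^_)
import Data.Integer.Properties as ℤₚ
open import Data.Integer.Tactic.RingSolver using (solve-∀)
open import Data.Fin using (Fin; zero; suc; punchIn)
import Data.Fin.Properties as Finₚ
import Data.Vec as Vec
open import Data.Vec using (_[_]≔_)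
open import Data.Vec.Properties using (lookup∘update; lookup∘update′; []=⇒lookup; lookup⇒[]=)
open import Data.Vec.Functional using (Vector; insertAt; _∷_)
open import Data.Vec.Functional.Properties using (insertAt-lookup; insertAt-punchIn)
open import Data.Empty using (⊥-elim)
open import Data.Sum using (_⊎_; inj₁; inj₂)
open import Data.Product using (Σ; _×_; _,_; proj₁; proj₂)
open import Data.Fin.Subset using (Subset; _∈_; _∉_; ⊤; inside; outside; ∣_∣)
open import Data.Fin.Subset.Properties using (∈⊤; ∣p∣≤n; ∣p∣≡n⇒p≡⊤; ∣⊤∣≡n)
open import Data.List as List using (List; map)
open import Relation.Nullary using (¬_; yes; no)
open import Relation.Nullary.Decidable using (decidable-stable; _×-dec_; _⊎-dec_)
open import Relation.Binary.PropositionalEquality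
import Algebra.Properties.Semiring.Sum ℤₚ.+-*-semiring as Sum

sumFin≡sum : ∀ {n} (f : Fin n → ℤ) → sumFin f ≡ Sum.sum f
sumFin≡sum {zero}  f = refl
sumFin≡sum {suc n} f = cong (f zero +_) (sumFin≡sum (λ i → f (suc i)))

sum-cong : ∀ {n} {f g : Fin n → ℤ} → (∀ i → f i ≡ g i) → sumFin f ≡ sumFin g
sum-cong {f = f} {g} f≗g = begin
  sumFin f   ≡⟨ sumFin≡sum f ⟩
  Sum.sum f  ≡⟨ Sum.sum-cong-≗ f≗g ⟩
  Sum.sum g  ≡⟨ sumFin≡sum g ⟨
  sumFin g   ∎
  where open ≡-Reasoning

sum-zero : ∀ {n} (f : Fin n → ℤ) → (∀ i → f i ≡ 0ℤ) → sumFin f ≡ 0ℤ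
sum-zero {n} f f≗0 = trans (sum-cong f≗0) (trans (sumFin≡sum {n} (λ _ → 0ℤ)) (Sum.sum-replicate-zero n))

sum-scale : ∀ {n} (x : ℤ) (f : Fin n → ℤ) → sumFin (λ i → x * f i) ≡ x * sumFin f
sum-scale x f = begin
  sumFin (λ i → x * f i)  ≡⟨ sumFin≡sum (λ i → x * f i) ⟩
  Sum.sum (λ i → x * f i) ≡⟨ Sum.*-distribˡ-sum x f ⟨
  x * Sum.sum f           ≡⟨ cong (x *_) (sumFin≡sum f) ⟨
  x * sumFin f            ∎
  where open ≡-Reasoning

sum-linear : ∀ {n} (x y : ℤ) (f g : Fin n → ℤ) →
  sumFin (λ i → x * f i + y * g i) ≡ x * sumFin f + y * sumFin g
sum-linear x y f g = begin
  sumFin (λ i → x * f i + y * g i)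
    ≡⟨ sumFin≡sum (λ i → x * f i + y * g i) ⟩
  Sum.sum (λ i → x * f i + y * g i)
    ≡⟨ Sum.∑-distrib-+ (λ i → x * f i) (λ i → y * g i) ⟩
  Sum.sum (λ i → x * f i) + Sum.sum (λ i → y * g i)
    ≡⟨ cong₂ _+_ (sumFin≡sum (λ i → x * f i)) (sumFin≡sum (λ i → y * g i)) ⟨
  sumFin (λ i → x * f i) + sumFin (λ i → y * g i)
    ≡⟨ cong₂ _+_ (sum-scale x f) (sum-scale y g) ⟩
  x * sumFin f + y * sumFin g ∎
  where open ≡-Reasoning

sum-remove : ∀ {n} (t : Fin (suc n)) (f : Fin (suc n) → ℤ) →
  sumFin f ≡ f t + sumFin (λ i → f (punchIn t i))
sum-remove t f = begin
  sumFin f                            ≡⟨ sumFin≡sum f ⟩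
  Sum.sum f                           ≡⟨ Sum.sum-remove f ⟩
  f t + Sum.sum (λ i → f (punchIn t i)) ≡⟨ cong (f t +_) (sumFin≡sum (λ i → f (punchIn t i))) ⟨
  f t + sumFin (λ i → f (punchIn t i)) ∎
  where open ≡-Reasoning

-- A sum over an empty index set (of size zero only propositionally) is zero.
sum-empty : ∀ {n} (f : Fin n → ℤ) → n ≡ 0 → sumFin f ≡ 0ℤ
sum-empty f refl = refl

sum-comm : ∀ {m n} (f : Fin m → Fin n → ℤ) →
  sumFin (λ i → sumFin (λ j → f i j)) ≡ sumFin (λ j → sumFin (λ i → f i j))
sum-comm f = begin
  sumFin (λ i → sumFin (λ j → f i j))   ≡⟨ sum-cong (λ i → sumFin≡sum (f i)) ⟩
  sumFin (λ i → Sum.sum (λ j → f i j))  ≡⟨ sumFin≡sum (λ i → Sum.sum (f i)) ⟩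
  Sum.sum (λ i → Sum.sum (λ j → f i j)) ≡⟨ Sum.∑-comm f ⟩
  Sum.sum (λ j → Sum.sum (λ i → f i j)) ≡⟨ sumFin≡sum (λ j → Sum.sum (λ i → f i j)) ⟨
  sumFin (λ j → Sum.sum (λ i → f i j))  ≡⟨ sum-cong (λ j → sumFin≡sum (λ i → f i j)) ⟨
  sumFin (λ j → sumFin (λ i → f i j))   ∎
  where open ≡-Reasoning

lincomb : ∀ {N r} → (Fin r → ℤ) → (Fin r → Vector ℤ N) → Vector ℤ N
lincomb a z j = sumFin (λ t → a t * z t j)

IsZero : ∀ {N} → Vector ℤ N → Set
IsZero v = ∀ j → v j ≡ 0ℤ

IndependentModulo : ∀ {N r} → (Vector ℤ N → Set) → (Fin r → Vector ℤ N) → Set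
IndependentModulo P z = ∀ a → P (lincomb a z) → ∀ t → a t ≡ 0ℤ

Independent : ∀ {N r} → (Fin r → Vector ℤ N) → Set
Independent = IndependentModulo IsZero

record IsSubmodule {N} (P : Vector ℤ N → Set) : Set where
  field
    combine  : ∀ x y {u v} → P u → P v → P (λ j → x * u j + y * v j)
    respects : ∀ {u v} → (∀ j → u j ≡ v j) → P u → P v

_⊕_ : ∀ {N} → (Vector ℤ N → Set) → Vector ℤ N → Vector ℤ N → Set
(P ⊕ u) v = Σ ℤ λ c → P (λ j → v j + (- c) * u j)

combine-zero : ∀ x y {p q : ℤ} → p ≡ 0ℤ → q ≡ 0ℤ → x * p + y * q ≡ 0ℤ
combine-zero x y refl refl = cong₂ _+_ (ℤₚ.*-zeroʳ x) (ℤₚ.*-zeroʳ y)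

nonzero-cancel : ∀ {a b : ℤ} → ¬ a ≡ 0ℤ → a * b ≡ 0ℤ → b ≡ 0ℤ
nonzero-cancel {a} a≢0 ab≡0 with ℤₚ.i*j≡0⇒i≡0∨j≡0 a ab≡0
... | inj₁ a≡0 = ⊥-elim (a≢0 a≡0)
... | inj₂ b≡0 = b≡0

lincomb-scale : ∀ {N r} (m : ℤ) (a : Fin r → ℤ) (z : Fin r → Vector ℤ N) j →
  lincomb (λ t → m * a t) z j ≡ m * lincomb a z j
lincomb-scale m a z j =
  trans (sum-cong (λ t → ℤₚ.*-assoc m (a t) (z t j))) (sum-scale m (λ t → a t * z t j))

lincomb-linear : ∀ {N r} (x y : ℤ) (a b : Fin r → ℤ) (z : Fin r → Vector ℤ N) j →
  lincomb (λ t → x * a t + y * b t) z j ≡ x * lincomb a z j + y * lincomb b z j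
lincomb-linear x y a b z j =
  trans (sum-cong (λ t → distrib x y (a t) (b t) (z t j)))
        (sum-linear x y (λ t → a t * z t j) (λ t → b t * z t j))
  where
  distrib : ∀ x y p q w → (x * p + y * q) * w ≡ x * (p * w) + y * (q * w)
  distrib = solve-∀

lincomb-remove : ∀ {N r} (t : Fin (suc r)) (a : Fin (suc r) → ℤ) (z : Fin (suc r) → Vector ℤ N) j →
  lincomb a z j ≡ a t * z t j + lincomb (λ i → a (punchIn t i)) (λ i → z (punchIn t i)) j
lincomb-remove t a z j = sum-remove t (λ s → a s * z s j)

lincomb-insertAt : ∀ {N r} (b : Fin r → ℤ) (t : Fin (suc r)) (x : ℤ) (z : Fin (suc r) → Vector ℤ N) j →
  lincomb (insertAt b t x) z j ≡ x * z t j + lincomb b (λ i → z (punchIn t i)) j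
lincomb-insertAt b t x z j =
  trans (lincomb-remove t (insertAt b t x) z j)
        (cong₂ (λ p q → p * z t j + q) (insertAt-lookup b t x)
               (sum-cong (λ i → cong (_* z (punchIn t i) j) (insertAt-punchIn b t x i))))

independentModulo-anti : ∀ {N r} {P Q : Vector ℤ N → Set} {z : Fin r → Vector ℤ N} →
  (∀ {v} → P v → Q v) → IndependentModulo Q z → IndependentModulo P z
independentModulo-anti P⊆Q indep a p = indep a (P⊆Q p)

independentModulo-scale : ∀ {N r} {P Q : Vector ℤ N → Set} {z : Fin r → Vector ℤ N} {m : ℤ} →
  IsSubmodule P → ¬ m ≡ 0ℤ → (∀ {v} → Q v → P (λ j → m * v j)) →
  IndependentModulo P z → IndependentModulo Q z
independentModulo-scale {z = z} {m} sub m≢0 mQ⊆P indep a q t =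
  nonzero-cancel m≢0 (indep (λ s → m * a s) (respects (λ j → sym (lincomb-scale m a z j)) (mQ⊆P q)) t)
  where open IsSubmodule sub

cons-independent : ∀ {N r} {v : Vector ℤ N} {z : Fin r → Vector ℤ N} (e : Fin N) →
  ¬ v e ≡ 0ℤ → (∀ t → z t e ≡ 0ℤ) → Independent z → Independent (v ∷ z)
cons-independent {v = v} {z} e ve≢0 ze≡0 indep a comb≡0 = coefficient
  where
  rest : Vector ℤ _
  rest = lincomb (λ t → a (suc t)) z

  rest-at-e : rest e ≡ 0ℤ
  rest-at-e = sum-zero _ (λ t → trans (cong (a (suc t) *_) (ze≡0 t)) (ℤₚ.*-zeroʳ (a (suc t))))

  head≡0 : a zero ≡ 0ℤ
  head≡0 = nonzero-cancel ve≢0 (begin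
    v e * a zero                  ≡⟨ ℤₚ.*-comm (v e) (a zero) ⟩
    a zero * v e                  ≡⟨ ℤₚ.+-identityʳ (a zero * v e) ⟨
    a zero * v e + 0ℤ             ≡⟨ cong (a zero * v e +_) rest-at-e ⟨
    a zero * v e + rest e         ≡⟨ comb≡0 e ⟩
    0ℤ                            ∎)
    where open ≡-Reasoning

  rest≡0 : ∀ j → rest j ≡ 0ℤ
  rest≡0 j = begin
    rest j                        ≡⟨ ℤₚ.+-identityˡ (rest j) ⟨
    0ℤ + rest j                   ≡⟨ cong (_+ rest j) (ℤₚ.*-zeroˡ (v j)) ⟨
    0ℤ * v j + rest j             ≡⟨ cong (λ x → x * v j + rest j) head≡0 ⟨
    a zero * v j + rest j         ≡⟨ comb≡0 j ⟩
    0ℤ                            ∎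
    where open ≡-Reasoning

  coefficient : ∀ t → a t ≡ 0ℤ
  coefficient zero    = head≡0
  coefficient (suc t) = indep (λ s → a (suc s)) rest≡0 t

cons-independentModulo : ∀ {N r} {P : Vector ℤ N → Set} {u : Vector ℤ N} {z : Fin r → Vector ℤ N} →
  IsSubmodule P → (∀ c → P (λ j → c * u j) → c ≡ 0ℤ) →
  IndependentModulo (P ⊕ u) z → IndependentModulo P (u ∷ z)
cons-independentModulo {u = u} {z} sub u-free indep a p = coefficient
  where
  open IsSubmodule sub
  rest : Vector ℤ _
  rest = lincomb (λ t → a (suc t)) z

  tail≡0 : ∀ t → a (suc t) ≡ 0ℤ
  tail≡0 = indep (λ t → a (suc t)) (- a zero , respects (λ j → reorder (a zero) (u j) (rest j)) p)
    where
    reorder : ∀ x y w → x * y + w ≡ w + (- - x) * y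
    reorder = solve-∀

  rest≡0 : ∀ j → rest j ≡ 0ℤ
  rest≡0 j = sum-zero _ (λ t → trans (cong (_* z t j) (tail≡0 t)) (ℤₚ.*-zeroˡ (z t j)))

  coefficient : ∀ t → a t ≡ 0ℤ
  coefficient zero    = u-free (a zero)
    (respects (λ j → trans (cong (a zero * u j +_) (rest≡0 j)) (ℤₚ.+-identityʳ (a zero * u j))) p)
  coefficient (suc t) = tail≡0 t

-- Clearing the e-th coordinate with the help of z_t: the other members z_i are
-- replaced by z_t(e)·z_i − z_i(e)·z_t.
eliminate : ∀ {N r} → (Fin (suc r) → Vector ℤ N) → Fin (suc r) → Fin N → Fin r → Vector ℤ N
eliminate z t e i j = z t e * z (punchIn t i) j + (- z (punchIn t i) e) * z t j

eliminate-vanishes : ∀ {N r} (z : Fin (suc r) → Vector ℤ N) t e i → eliminate z t e i e ≡ 0ℤ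
eliminate-vanishes z t e i = cancel (z t e) (z (punchIn t i) e)
  where
  cancel : ∀ x y → x * y + (- y) * x ≡ 0ℤ
  cancel = solve-∀

eliminate-independent : ∀ {N r} {z : Fin (suc r) → Vector ℤ N} {t : Fin (suc r)} {e : Fin N} →
  Independent z → ¬ z t e ≡ 0ℤ → Independent (eliminate z t e)
eliminate-independent {r = r} {z} {t} {e} indep pivot≢0 b comb≡0 i =
  nonzero-cancel pivot≢0 (trans (sym (insertAt-punchIn scaled t (- L e) i))
                                (indep c c-comb≡0 (punchIn t i)))
  where
  z′ : Fin r → Vector ℤ _
  z′ i = z (punchIn t i)
  L : Vector ℤ _
  L = lincomb b z′
  scaled : Fin r → ℤ
  scaled i = z t e * b i
  c : Fin (suc r) → ℤ
  c = insertAt scaled t (- L e)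

  lincomb-eliminate : ∀ j → lincomb b (eliminate z t e) j ≡ z t e * L j + (- z t j) * L e
  lincomb-eliminate j =
    trans (sum-cong (λ i → expand (b i) (z t e) (z′ i j) (z′ i e) (z t j)))
          (sum-linear (z t e) (- z t j) (λ i → b i * z′ i j) (λ i → b i * z′ i e))
    where
    expand : ∀ β φ x y w → β * (φ * x + (- y) * w) ≡ φ * (β * x) + (- w) * (β * y)
    expand = solve-∀

  c-comb≡0 : ∀ j → lincomb c z j ≡ 0ℤ
  c-comb≡0 j = begin
    lincomb c z j                      ≡⟨ lincomb-insertAt scaled t (- L e) z j ⟩
    (- L e) * z t j + lincomb scaled z′ j ≡⟨ cong ((- L e) * z t j +_) (lincomb-scale (z t e) b z′ j) ⟩
    (- L e) * z t j + z t e * L j      ≡⟨ reorder (L e) (z t j) (z t e * L j) ⟩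
    z t e * L j + (- z t j) * L e      ≡⟨ lincomb-eliminate j ⟨
    lincomb b (eliminate z t e) j      ≡⟨ comb≡0 j ⟩
    0ℤ                                 ∎
    where
    open ≡-Reasoning
    reorder : ∀ x y w → (- x) * y + w ≡ w + (- y) * x
    reorder = solve-∀

drop-independent : ∀ {N r} {P : Vector ℤ N → Set} {u : Vector ℤ N} {z : Fin (suc r) → Vector ℤ N}
  {a : Fin (suc r) → ℤ} {t : Fin (suc r)} {c : ℤ} →
  IsSubmodule P → IndependentModulo P z → ¬ a t ≡ 0ℤ → ¬ c ≡ 0ℤ →
  P (λ j → lincomb a z j + (- c) * u j) → IndependentModulo (P ⊕ u) (λ i → z (punchIn t i))
drop-independent {r = r} {P} {u} {z} {a} {t} {c} sub indep at≢0 c≢0 pa b (c′ , pb) i =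
  nonzero-cancel c≢0 (begin
    c * b i                               ≡⟨ drop-term (c * b i) (a (punchIn t i)) ⟨
    c * b i + 0ℤ * a (punchIn t i)        ≡⟨ cong (λ x → c * b i + x * a (punchIn t i)) -c′≡0 ⟨
    c * b i + (- c′) * a (punchIn t i)    ≡⟨ insertAt-punchIn d′ t d-at-t i ⟨
    d (punchIn t i)                       ≡⟨ d≡0 (punchIn t i) ⟩
    0ℤ                                    ∎)
  where
  open IsSubmodule sub
  open ≡-Reasoning
  z′ : Fin r → Vector ℤ _
  z′ i = z (punchIn t i)
  d′ : Fin r → ℤ
  d′ i = c * b i + (- c′) * a (punchIn t i)
  d-at-t : ℤ
  d-at-t = (- c′) * a t
  d : Fin (suc r) → ℤ
  d = insertAt d′ t d-at-t

  -- c·(Σ b z′ − c′u) − c′·(Σ a z − c u) = Σ d z: the u-terms cancel.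
  d-comb : ∀ x → c * (lincomb b z′ x + (- c′) * u x) + (- c′) * (lincomb a z x + (- c) * u x)
               ≡ lincomb d z x
  d-comb x = begin
    c * (lincomb b z′ x + (- c′) * u x) + (- c′) * (lincomb a z x + (- c) * u x)
      ≡⟨ cong (λ y → c * (lincomb b z′ x + (- c′) * u x) + (- c′) * (y + (- c) * u x))
              (lincomb-remove t a z x) ⟩
    c * (lincomb b z′ x + (- c′) * u x)
      + (- c′) * ((a t * z t x + lincomb (λ i → a (punchIn t i)) z′ x) + (- c) * u x)
      ≡⟨ regroup c c′ (a t) (z t x) (lincomb b z′ x) (lincomb (λ i → a (punchIn t i)) z′ x) (u x) ⟩
    d-at-t * z t x + (c * lincomb b z′ x + (- c′) * lincomb (λ i → a (punchIn t i)) z′ x)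
      ≡⟨ cong (d-at-t * z t x +_) (lincomb-linear c (- c′) b (λ i → a (punchIn t i)) z′ x) ⟨
    d-at-t * z t x + lincomb d′ z′ x
      ≡⟨ lincomb-insertAt d′ t d-at-t z x ⟨
    lincomb d z x ∎
    where
    regroup : ∀ c c′ α ζ B A υ →
      c * (B + (- c′) * υ) + (- c′) * ((α * ζ + A) + (- c) * υ) ≡ (- c′) * α * ζ + (c * B + (- c′) * A)
    regroup = solve-∀

  d≡0 : ∀ s → d s ≡ 0ℤ
  d≡0 = indep d (respects d-comb (combine c (- c′) pb pa))

  -c′≡0 : - c′ ≡ 0ℤ
  -c′≡0 = nonzero-cancel at≢0
    (trans (ℤₚ.*-comm (a t) (- c′)) (trans (sym (insertAt-lookup d′ t d-at-t)) (d≡0 t)))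

  drop-term : ∀ x y → x + 0ℤ * y ≡ x
  drop-term = solve-∀

module _ (K : CWComplex) where
  open CWComplex K

  ∂-cong : ∀ i {c d : Chain K (suc i)} → (∀ b → c b ≡ d b) → ∀ a → ∂ K i c a ≡ ∂ K i d a
  ∂-cong i c≗d a = sum-cong (λ b → cong (bd i a b *_) (c≗d b))

  ∂-linear : ∀ i (x y : ℤ) (c d : Chain K (suc i)) a →
    ∂ K i (λ b → x * c b + y * d b) a ≡ x * ∂ K i c a + y * ∂ K i d a
  ∂-linear i x y c d a =
    trans (sum-cong (λ b → distrib x y (bd i a b) (c b) (d b)))
          (sum-linear x y (λ b → bd i a b * c b) (λ b → bd i a b * d b))
    where
    distrib : ∀ x y p q w → p * (x * q + y * w) ≡ x * (p * q) + y * (p * w)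
    distrib = solve-∀

  ∂∘∂ : ∀ i (c : Chain K (suc (suc i))) a → ∂ K i (∂ K (suc i) c) a ≡ 0ℤ
  ∂∘∂ i c a = begin
    sumFin (λ b → bd i a b * sumFin (λ d → bd (suc i) b d * c d))
      ≡⟨ sum-cong (λ b → sum-scale (bd i a b) (λ d → bd (suc i) b d * c d)) ⟨
    sumFin (λ b → sumFin (λ d → bd i a b * (bd (suc i) b d * c d)))
      ≡⟨ sum-comm (λ b d → bd i a b * (bd (suc i) b d * c d)) ⟩
    sumFin (λ d → sumFin (λ b → bd i a b * (bd (suc i) b d * c d)))
      ≡⟨ sum-cong (λ d → trans (sum-cong (λ b → reassoc (bd i a b) (bd (suc i) b d) (c d)))
                               (sum-scale (c d) (λ b → bd i a b * bd (suc i) b d))) ⟩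
    sumFin (λ d → c d * sumFin (λ b → bd i a b * bd (suc i) b d))
      ≡⟨ sum-zero _ (λ d → trans (cong (c d *_) (bd∘bd i a d)) (ℤₚ.*-zeroʳ (c d))) ⟩
    0ℤ ∎
    where
    open ≡-Reasoning
    reassoc : ∀ x y w → x * (y * w) ≡ w * (x * y)
    reassoc = solve-∀

  cellsOf-below : ∀ S i → ¬ i ≡ dim → cellsOf K S i ≡ ⊤
  cellsOf-below S i i≢dim with i ≟ dim
  ... | yes i≡dim = ⊥-elim (i≢dim i≡dim)
  ... | no  _     = refl

  cellsOf-top : ∀ S → cellsOf K S dim ≡ S
  cellsOf-top S with dim ≟ dim
  ... | yes p  = cong (λ q → subst (λ j → Subset (cells j)) q S) (ℕₚ.≡-irrelevant (sym p) refl)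
  ... | no  ¬p = ⊥-elim (¬p refl)

  inSub-below : ∀ S i c → ¬ i ≡ dim → InSub K S i c
  inSub-below S i c i≢dim j j∉ = ⊥-elim (j∉ (subst (j ∈_) (sym (cellsOf-below S i i≢dim)) ∈⊤))

  cycle-below : ∀ S S′ i z → ¬ i ≡ dim → IsCycle K S i z → IsCycle K S′ i z
  cycle-below S S′ zero    z i≢dim _          = inSub-below S′ zero z i≢dim
  cycle-below S S′ (suc i) z i≢dim (_ , ∂z≡0) = inSub-below S′ (suc i) z i≢dim , ∂z≡0

  boundary-cycle-below : ∀ S i c → ¬ i ≡ dim → IsCycle K S i (∂ K i c)
  boundary-cycle-below S zero    c i≢dim = inSub-below S zero (∂ K zero c) i≢dim
  boundary-cycle-below S (suc i) c i≢dim = inSub-below S (suc i) (∂ K (suc i) c) i≢dim , ∂∘∂ i c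

  betti-bound : ∀ {S i b r} {z : Fin r → Chain K i} → IsBetti K S i b → IndepInHomology K S i z → r ≤ b
  betti-bound (_ , maximal) indep = maximal _ _ indep

  betti-≤ : ∀ {S₁ S₂ i b₁ b₂} → IsBetti K S₁ i b₁ → IsBetti K S₂ i b₂ →
    (∀ {r} (z : Fin r → Chain K i) → IndepInHomology K S₁ i z → IndepInHomology K S₂ i z) →
    b₁ ≤ b₂
  betti-≤ ((basis₁ , indep₁) , _) β₂ transport = betti-bound β₂ (transport basis₁ indep₁)

  betti-≡ : ∀ {S₁ S₂ i b₁ b₂} → IsBetti K S₁ i b₁ → IsBetti K S₂ i b₂ →
    (∀ {r} (z : Fin r → Chain K i) → IndepInHomology K S₁ i z → IndepInHomology K S₂ i z) →
    (∀ {r} (z : Fin r → Chain K i) → IndepInHomology K S₂ i z → IndepInHomology K S₁ i z) →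
    b₁ ≡ b₂
  betti-≡ β₁ β₂ to from = ℕₚ.≤-antisym (betti-≤ β₁ β₂ to) (betti-≤ β₂ β₁ from)

  betti-suc : ∀ {S₁ S₂ i b₁ b₂} → IsBetti K S₁ i b₁ → IsBetti K S₂ i b₂ →
    (∀ {r} (z : Fin r → Chain K i) → IndepInHomology K S₁ i z →
       Σ (Fin (suc r) → Chain K i) (IndepInHomology K S₂ i)) →
    (∀ {r} (z : Fin (suc r) → Chain K i) → IndepInHomology K S₂ i z → r ≤ b₁) →
    b₂ ≡ suc b₁
  betti-suc {S₂ = S₂} {i} {b₁} ((basis₁ , indep₁) , _) β₂@((basis₂ , indep₂) , _) extend shrink =
    ℕₚ.≤-antisym (at-most basis₂ indep₂) (betti-bound β₂ (proj₂ (extend basis₁ indep₁)))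
    where
    at-most : ∀ {r} (z : Fin r → Chain K i) → IndepInHomology K S₂ i z → r ≤ suc b₁
    at-most {zero}  z _     = z≤n
    at-most {suc r} z indep = s≤s (shrink z indep)

module _ {m} (S : Subset m) (e : Fin m) where

  e∈S⁺ : e ∈ S [ e ]≔ inside
  e∈S⁺ = lookup⇒[]= e (S [ e ]≔ inside) (lookup∘update e S inside)

  S⊆S⁺ : ∀ {j} → j ∈ S → j ∈ S [ e ]≔ inside
  S⊆S⁺ {j} j∈S with j Finₚ.≟ e
  ... | yes refl = e∈S⁺
  ... | no  j≢e  = lookup⇒[]= j _ (trans (lookup∘update′ j≢e S inside) ([]=⇒lookup j∈S))

  S⁺⊆S : ∀ {j} → j ∈ S [ e ]≔ inside → ¬ j ≡ e → j ∈ S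
  S⁺⊆S {j} j∈S⁺ j≢e = lookup⇒[]= j S (trans (sym (lookup∘update′ j≢e S inside)) ([]=⇒lookup j∈S⁺))

∣S⁺∣ : ∀ {m} (S : Subset m) e → e ∉ S → ∣ S [ e ]≔ inside ∣ ≡ suc ∣ S ∣
∣S⁺∣ (outside Vec.∷ S) zero    e∉S = refl
∣S⁺∣ (inside  Vec.∷ S) zero    e∉S = ⊥-elim (e∉S Vec.here)
∣S⁺∣ (outside Vec.∷ S) (suc e) e∉S = ∣S⁺∣ S e (λ e∈S → e∉S (Vec.there e∈S))
∣S⁺∣ (inside  Vec.∷ S) (suc e) e∉S = cong suc (∣S⁺∣ S e (λ e∈S → e∉S (Vec.there e∈S)))

missing : ∀ {m} (S : Subset m) → ¬ S ≡ ⊤ → Σ (Fin m) (_∉ S)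
missing Vec.[]              S≢⊤ = ⊥-elim (S≢⊤ refl)
missing (outside Vec.∷ S) S≢⊤ = zero , λ ()
missing (inside  Vec.∷ S) S≢⊤ with missing S (λ S≡⊤ → S≢⊤ (cong (inside Vec.∷_) S≡⊤))
... | e , e∉S = suc e , λ { (Vec.there e∈S) → e∉S e∈S }

-- From here on K has dimension d + 1 ≥ 1 (the paper's k is d + 1); its top cells form Fin n.
module TopDimension (d : ℕ) (cells : ℕ → ℕ)
  (bd : (i : ℕ) → Fin (cells i) → Fin (cells (suc i)) → ℤ)
  (bd∘bd : ∀ i (a : Fin (cells i)) (c : Fin (cells (suc (suc i)))) →
           sumFin (λ b → bd i a b * bd (suc i) b c) ≡ 0ℤ)
  (top : 1 ≤ cells (suc d)) (above : ∀ i → suc d < i → cells i ≡ 0) where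

  K : CWComplex
  K = record { dim = suc d ; cells = cells ; bd = bd ; bd∘bd = bd∘bd ; top = top ; above = above }

  n : ℕ
  n = cells (suc d)

  d≢dim : ¬ d ≡ suc d
  d≢dim d≡1+d = ℕₚ.1+n≢n (sym d≡1+d)

  Supported : Subset n → Chain K (suc d) → Set
  Supported S c = ∀ j → j ∉ S → c j ≡ 0ℤ

  TopCycle : Subset n → Chain K (suc d) → Set
  TopCycle S z = Supported S z × IsZero (∂ K d z)

  Bounded : Subset n → Chain K d → Set
  Bounded S x = Σ (Chain K (suc d)) λ c → Supported S c × (∀ a → ∂ K d c a ≡ x a)

  supported⇒inSub : ∀ {S c} → Supported S c → InSub K S (suc d) c
  supported⇒inSub {S} supp j j∉ = supp j (subst (j ∉_) (cellsOf-top K S) j∉)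

  inSub⇒supported : ∀ {S c} → InSub K S (suc d) c → Supported S c
  inSub⇒supported {S} inSub j j∉ = inSub j (subst (j ∉_) (sym (cellsOf-top K S)) j∉)

  topCycle-submodule : ∀ S → IsSubmodule (TopCycle S)
  topCycle-submodule S = record
    { combine  = λ x y (u-supp , ∂u≡0) (v-supp , ∂v≡0) →
        (λ j j∉ → combine-zero x y (u-supp j j∉) (v-supp j j∉)) ,
        (λ a → trans (∂-linear K d x y _ _ a) (combine-zero x y (∂u≡0 a) (∂v≡0 a)))
    ; respects = λ u≗v (u-supp , ∂u≡0) →
        (λ j j∉ → trans (sym (u≗v j)) (u-supp j j∉)) ,
        (λ a → trans (sym (∂-cong K d u≗v a)) (∂u≡0 a))
    }

  bounded-submodule : ∀ S → IsSubmodule (Bounded S)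
  bounded-submodule S = record
    { combine  = λ x y (c , c-supp , ∂c) (c′ , c′-supp , ∂c′) →
        (λ j → x * c j + y * c′ j) ,
        (λ j j∉ → combine-zero x y (c-supp j j∉) (c′-supp j j∉)) ,
        (λ a → trans (∂-linear K d x y c c′ a) (cong₂ (λ p q → x * p + y * q) (∂c a) (∂c′ a)))
    ; respects = λ u≗v (c , c-supp , ∂c) → c , c-supp , (λ a → trans (∂c a) (u≗v a))
    }

  -- There are no cells above the top, so every top boundary is zero.
  top-boundary-zero : ∀ {S x} → IsBoundary K S (suc d) x → IsZero x
  top-boundary-zero (c , _ , ∂c≡x) j =
    trans (sym (∂c≡x j)) (sum-empty _ (above (suc (suc d)) (ℕₚ.n<1+n (suc d))))

  zero-top-boundary : ∀ {S x} → IsZero x → IsBoundary K S (suc d) x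
  zero-top-boundary x≡0 =
    (λ _ → 0ℤ) , (λ _ _ → refl) ,
    (λ a → trans (sum-zero _ (λ b → ℤₚ.*-zeroʳ (bd (suc d) a b))) (sym (x≡0 a)))

  topIndep⇒ : ∀ {S r} {z : Fin r → Chain K (suc d)} →
    IndepInHomology K S (suc d) z → (∀ t → TopCycle S (z t)) × Independent z
  topIndep⇒ {S} (cycles , indep) =
    (λ t → inSub⇒supported (proj₁ (cycles t)) , proj₂ (cycles t)) ,
    independentModulo-anti (λ {v} → zero-top-boundary {S} {v}) indep

  ⇒topIndep : ∀ {S r} {z : Fin r → Chain K (suc d)} →
    (∀ t → TopCycle S (z t)) → Independent z → IndepInHomology K S (suc d) z
  ⇒topIndep {S} cycles indep =
    (λ t → supported⇒inSub (proj₁ (cycles t)) , proj₂ (cycles t)) ,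
    independentModulo-anti (λ {v} → top-boundary-zero {S} {v}) indep

  lowIndep⇒ : ∀ {S r} {z : Fin r → Chain K d} →
    IndepInHomology K S d z → IndependentModulo (Bounded S) z
  lowIndep⇒ (_ , indep) a (c , c-supp , ∂c) = indep a (c , supported⇒inSub c-supp , ∂c)

  -- (the cycle condition may be checked in any subcomplex S₀: below the top it does not depend on it)
  ⇒lowIndep : ∀ {S₀ S r} {z : Fin r → Chain K d} →
    (∀ t → IsCycle K S₀ d (z t)) → IndependentModulo (Bounded S) z → IndepInHomology K S d z
  ⇒lowIndep {S₀} {S} cycles indep =
    (λ t → cycle-below K S₀ S d _ d≢dim (cycles t)) ,
    (λ a (c , c-inSub , ∂c) → indep a (c , inSub⇒supported c-inSub , ∂c))

  module AddCell (S : Subset n) (e : Fin n) (e∉S : e ∉ S) where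

    S⁺ : Subset n
    S⁺ = S [ e ]≔ inside

    δ : Chain K (suc d)
    δ j with j Finₚ.≟ e
    ... | yes _ = 1ℤ
    ... | no  _ = 0ℤ

    δ-at-e : δ e ≡ 1ℤ
    δ-at-e with e Finₚ.≟ e
    ... | yes _   = refl
    ... | no  e≢e = ⊥-elim (e≢e refl)

    δ-off : ∀ {j} → ¬ j ≡ e → δ j ≡ 0ℤ
    δ-off {j} j≢e with j Finₚ.≟ e
    ... | yes j≡e = ⊥-elim (j≢e j≡e)
    ... | no  _   = refl

    u : Chain K d
    u = ∂ K d δ

    strip : Chain K (suc d) → Chain K (suc d)
    strip c j = 1ℤ * c j + (- c e) * δ j

    strip-at-e : ∀ c → strip c e ≡ 0ℤ
    strip-at-e c = trans (cong (λ x → 1ℤ * c e + (- c e) * x) δ-at-e) (cancel (c e))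
      where
      cancel : ∀ x → 1ℤ * x + (- x) * 1ℤ ≡ 0ℤ
      cancel = solve-∀

    supported-up : ∀ {c} → Supported S c → Supported S⁺ c
    supported-up c-supp j j∉S⁺ = c-supp j (λ j∈S → j∉S⁺ (S⊆S⁺ S e j∈S))

    supported-down : ∀ {c} → Supported S⁺ c → c e ≡ 0ℤ → Supported S c
    supported-down {c} c-supp ce≡0 j j∉S with j Finₚ.≟ e
    ... | yes refl = ce≡0
    ... | no  j≢e  = c-supp j (λ j∈S⁺ → j∉S (S⁺⊆S S e j∈S⁺ j≢e))

    ∉S⁺⇒≢e : ∀ {j} → j ∉ S⁺ → ¬ j ≡ e
    ∉S⁺⇒≢e j∉S⁺ refl = j∉S⁺ (e∈S⁺ S e)

    δ-supported : Supported S⁺ δ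
    δ-supported j j∉S⁺ = δ-off (∉S⁺⇒≢e j∉S⁺)

    strip-supported : ∀ {c} → Supported S⁺ c → Supported S (strip c)
    strip-supported {c} c-supp = supported-down stripped-supp (strip-at-e c)
      where
      stripped-supp : Supported S⁺ (strip c)
      stripped-supp j j∉S⁺ =
        combine-zero 1ℤ (- c e) (c-supp j j∉S⁺) (δ-off (∉S⁺⇒≢e j∉S⁺))

    bounded-up : ∀ {x} → Bounded S x → Bounded S⁺ x
    bounded-up (c , c-supp , ∂c) = c , supported-up c-supp , ∂c

    bounded⁺⇒⊕ : ∀ {x} → Bounded S⁺ x → (Bounded S ⊕ u) x
    bounded⁺⇒⊕ (c , c-supp , ∂c) =
      c e , strip c , strip-supported c-supp ,
      (λ a → trans (∂-linear K d 1ℤ (- c e) c δ a)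
                   (cong (_+ (- c e) * u a) (trans (ℤₚ.*-identityˡ (∂ K d c a)) (∂c a))))

    ⊕⇒bounded⁺ : ∀ {x} → (Bounded S ⊕ u) x → Bounded S⁺ x
    ⊕⇒bounded⁺ {x} (m , c , c-supp , ∂c) =
      (λ j → 1ℤ * c j + m * δ j) ,
      (λ j j∉S⁺ → combine-zero 1ℤ m (supported-up c-supp j j∉S⁺) (δ-supported j j∉S⁺)) ,
      (λ a → trans (∂-linear K d 1ℤ m c δ a)
                   (trans (cong (λ y → 1ℤ * y + m * u a) (∂c a)) (cancel (x a) m (u a))))
      where
      cancel : ∀ y m w → 1ℤ * (y + (- m) * w) + m * w ≡ y
      cancel = solve-∀

    Torsion : Set
    Torsion = Σ ℤ λ m → ¬ m ≡ 0ℤ × Bounded S (λ a → m * u a)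

    topCycle-up : ∀ {z} → TopCycle S z → TopCycle S⁺ z
    topCycle-up (z-supp , ∂z≡0) = supported-up z-supp , ∂z≡0

    topCycle-down : ¬ Torsion → ∀ {z} → TopCycle S⁺ z → TopCycle S z
    topCycle-down ¬torsion {z} (z-supp , ∂z≡0) with z e ℤₚ.≟ 0ℤ
    ... | yes ze≡0 = supported-down z-supp ze≡0 , ∂z≡0
    ... | no  ze≢0 = ⊥-elim (¬torsion (- z e , -ze≢0 , bounds))
      where
      -ze≢0 : ¬ - z e ≡ 0ℤ
      -ze≢0 -ze≡0 = ze≢0 (trans (sym (ℤₚ.neg-involutive (z e))) (cong -_ -ze≡0))
      bounds : Bounded S (λ a → - z e * u a)
      bounds = IsSubmodule.respects (bounded-submodule S) (λ a → ℤₚ.+-identityˡ (- z e * u a))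
                 (proj₂ (bounded⁺⇒⊕ (z , z-supp , ∂z≡0)))

  module AddCellBetti (βk βk-1 : Subset n → ℕ)
    (isβk : ∀ S → IsBetti K S (suc d) (βk S)) (isβk-1 : ∀ S → IsBetti K S d (βk-1 S))
    (S : Subset n) (e : Fin n) (e∉S : e ∉ S) where
    open AddCell S e e∉S

    -- If m·∂e = ∂c₀ with c₀ in S, then m·e − c₀ is a new top cycle: the top Betti number grows.
    torsion⇒top-grows : Torsion → βk S⁺ ≡ suc (βk S)
    torsion⇒top-grows (m , m≢0 , c₀ , c₀-supp , ∂c₀) = betti-suc K (isβk S) (isβk S⁺) extend shrink
      where
      open IsSubmodule (topCycle-submodule S⁺)
      new : Chain K (suc d)
      new j = m * δ j + (- 1ℤ) * c₀ j

      new-cycle : TopCycle S⁺ new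
      new-cycle =
        (λ j j∉S⁺ → combine-zero m (- 1ℤ) (δ-supported j j∉S⁺) (supported-up c₀-supp j j∉S⁺)) ,
        (λ a → trans (∂-linear K d m (- 1ℤ) δ c₀ a) (trans (cong (λ y → m * u a + (- 1ℤ) * y) (∂c₀ a)) (cancel m (u a))))
        where
        cancel : ∀ m w → m * w + (- 1ℤ) * (m * w) ≡ 0ℤ
        cancel = solve-∀

      new-at-e : new e ≡ m
      new-at-e = trans (cong₂ (λ p q → m * p + (- 1ℤ) * q) δ-at-e (c₀-supp e e∉S)) (simplify m)
        where
        simplify : ∀ m → m * 1ℤ + (- 1ℤ) * 0ℤ ≡ m
        simplify = solve-∀

      extend : ∀ {r} (z : Fin r → Chain K (suc d)) → IndepInHomology K S (suc d) z →
        Σ (Fin (suc r) → Chain K (suc d)) (IndepInHomology K S⁺ (suc d))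
      extend z I with topIndep⇒ I
      ... | cycles , indep = new ∷ z ,
        ⇒topIndep (λ { zero → new-cycle ; (suc t) → topCycle-up (cycles t) })
                  (cons-independent e (λ new-e≡0 → m≢0 (trans (sym new-at-e) new-e≡0))
                                      (λ t → proj₁ (cycles t) e e∉S) indep)

      -- An independent family of S⁺ either avoids e altogether or, after clearing
      -- the e-coordinate with a member not vanishing there, yields one of S with one member less.
      shrink : ∀ {r} (z : Fin (suc r) → Chain K (suc d)) → IndepInHomology K S⁺ (suc d) z → r ≤ βk S
      shrink {r} z I with topIndep⇒ I | Finₚ.all? (λ t → z t e ℤₚ.≟ 0ℤ)
      ... | cycles , indep | yes all≡0 = ℕₚ.<⇒≤ (betti-bound K (isβk S)
            (⇒topIndep (λ t → supported-down (proj₁ (cycles t)) (all≡0 t) , proj₂ (cycles t)) indep))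
      ... | cycles , indep | no ¬all≡0 with Finₚ.¬∀⟶∃¬ _ _ (λ t → z t e ℤₚ.≟ 0ℤ) ¬all≡0
      ...   | t , zte≢0 = betti-bound K (isβk S) (⇒topIndep eliminated-cycle (eliminate-independent {z = z} indep zte≢0))
        where
        eliminated-cycle : ∀ i → TopCycle S (eliminate z t e i)
        eliminated-cycle i with combine (z t e) (- z (punchIn t i) e) (cycles (punchIn t i)) (cycles t)
        ... | supp , ∂≡0 = supported-down supp (eliminate-vanishes z t e i) , ∂≡0

    -- ... while the d-th Betti number stays: S and S⁺ bound the same chains up to the factor m.
    torsion⇒low-same : Torsion → βk-1 S⁺ ≡ βk-1 S
    torsion⇒low-same (m , m≢0 , m∂e-bounds) = betti-≡ K (isβk-1 S⁺) (isβk-1 S)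
      (λ z I → ⇒lowIndep (proj₁ I) (independentModulo-anti {z = z} (λ {v} → bounded-up {v}) (lowIndep⇒ I)))
      (λ z I → ⇒lowIndep (proj₁ I) (independentModulo-scale (bounded-submodule S) m≢0 scaled (lowIndep⇒ I)))
      where
      open IsSubmodule (bounded-submodule S)
      scaled : ∀ {x} → Bounded S⁺ x → Bounded S (λ j → m * x j)
      scaled {x} b⁺ with bounded⁺⇒⊕ b⁺
      ... | c , b = respects (λ j → cancel m c (x j) (u j)) (combine m c b m∂e-bounds)
        where
        cancel : ∀ m c y w → m * (y + (- c) * w) + c * (m * w) ≡ m * y
        cancel = solve-∀

    -- If ∂e is not torsion, S and S⁺ have the same top cycles ...
    ¬torsion⇒top-same : ¬ Torsion → βk S⁺ ≡ βk S
    ¬torsion⇒top-same ¬torsion = betti-≡ K (isβk S⁺) (isβk S)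
      (λ z I → ⇒topIndep (λ t → topCycle-down ¬torsion (proj₁ (topIndep⇒ I) t)) (proj₂ (topIndep⇒ I)))
      (λ z I → ⇒topIndep (λ t → topCycle-up (proj₁ (topIndep⇒ I) t)) (proj₂ (topIndep⇒ I)))

    -- ... and the class of ∂e is a new independent d-cycle that stops being one in S⁺.
    ¬torsion⇒low-drops : ¬ Torsion → suc (βk-1 S⁺) ≡ βk-1 S
    ¬torsion⇒low-drops ¬torsion = sym (betti-suc K (isβk-1 S⁺) (isβk-1 S) extend shrink)
      where
      ∂e-free : ∀ c → Bounded S (λ j → c * u j) → c ≡ 0ℤ
      ∂e-free c b with c ℤₚ.≟ 0ℤ
      ... | yes c≡0 = c≡0
      ... | no  c≢0 = ⊥-elim (¬torsion (c , c≢0 , b))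

      extend : ∀ {r} (z : Fin r → Chain K d) → IndepInHomology K S⁺ d z →
        Σ (Fin (suc r) → Chain K d) (IndepInHomology K S d)
      extend z I = u ∷ z ,
        ⇒lowIndep (λ { zero → boundary-cycle-below K S d δ d≢dim
                     ; (suc t) → cycle-below K S⁺ S d (z t) d≢dim (proj₁ I t) })
                  (cons-independentModulo (bounded-submodule S) ∂e-free
                    (independentModulo-anti {z = z} (λ {v} → ⊕⇒bounded⁺ {v}) (lowIndep⇒ I)))

      -- If a family independent in S had more than βk-1 S⁺ + 1 members, it would stay
      -- independent in S⁺: a relation there, with a_t ≠ 0, would involve ∂e nontrivially,
      -- and dropping z_t would leave a too large independent family of S⁺.
      shrink : ∀ {r} (z : Fin (suc r) → Chain K d) → IndepInHomology K S d z → r ≤ βk-1 S⁺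
      shrink {r} z I = decidable-stable (r ℕ.≤? βk-1 S⁺) λ r≰ →
        r≰ (ℕₚ.<⇒≤ (betti-bound K (isβk-1 S⁺) (⇒lowIndep (proj₁ I) (independent⁺ r≰))))
        where
        independent⁺ : ¬ r ≤ βk-1 S⁺ → IndependentModulo (Bounded S⁺) z
        independent⁺ r≰ a b⁺ t with bounded⁺⇒⊕ b⁺
        ... | c , b with c ℤₚ.≟ 0ℤ
        ...   | yes refl = lowIndep⇒ I a (IsSubmodule.respects (bounded-submodule S) (λ j → drop-zero (lincomb a z j) (u j)) b) t
          where
          drop-zero : ∀ x y → x + (- 0ℤ) * y ≡ x
          drop-zero = solve-∀
        ...   | no c≢0 with a t ℤₚ.≟ 0ℤ
        ...     | yes at≡0 = at≡0
        ...     | no  at≢0 = ⊥-elim (r≰ (betti-bound K (isβk-1 S⁺)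
                    (⇒lowIndep (λ i → proj₁ I (punchIn t i))
                      (independentModulo-anti {z = λ i → z (punchIn t i)} (λ {v} → bounded⁺⇒⊕ {v})
                        (drop-independent {z = z} {a} {t} (bounded-submodule S) (lowIndep⇒ I) at≢0 c≢0 b)))))

    add-cell : (βk S⁺ ≡ suc (βk S) × βk-1 S⁺ ≡ βk-1 S) ⊎ (βk S⁺ ≡ βk S × suc (βk-1 S⁺) ≡ βk-1 S)
    add-cell = decidable-stable
      (((βk S⁺ ≟ suc (βk S)) ×-dec (βk-1 S⁺ ≟ βk-1 S)) ⊎-dec ((βk S⁺ ≟ βk S) ×-dec (suc (βk-1 S⁺) ≟ βk-1 S)))
      (λ ¬goal → torsion-or-not λ
        { (inj₁ torsion)  → ¬goal (inj₁ (torsion⇒top-grows torsion , torsion⇒low-same torsion))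
        ; (inj₂ ¬torsion) → ¬goal (inj₂ (¬torsion⇒top-same ¬torsion , ¬torsion⇒low-drops ¬torsion)) })
      where
      torsion-or-not : ¬ ¬ (Torsion ⊎ ¬ Torsion)
      torsion-or-not ¬lem = ¬lem (inj₂ (λ torsion → ¬lem (inj₁ torsion)))

module Exchange {n} (f g : Subset n → ℕ)
  (add : ∀ S e → e ∉ S →
     (f (S [ e ]≔ inside) ≡ suc (f S) × g (S [ e ]≔ inside) ≡ g S) ⊎
     (f (S [ e ]≔ inside) ≡ f S × suc (g (S [ e ]≔ inside)) ≡ g S)) where

  climb : ∀ m S → m ℕ.+ ∣ S ∣ ≡ n → Σ ℕ λ D → g S ≡ g ⊤ ℕ.+ D × f ⊤ ℕ.+ D ≡ f S ℕ.+ m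
  climb zero S |S|≡n with ∣p∣≡n⇒p≡⊤ {p = S} |S|≡n
  ... | refl = 0 , sym (ℕₚ.+-identityʳ (g ⊤)) , refl
  climb (suc m) S m+|S|≡n with missing S S≢⊤
    where
    S≢⊤ : ¬ S ≡ ⊤
    S≢⊤ refl = ℕₚ.m+1+n≢n m (trans (ℕₚ.+-suc m n) (trans (cong (λ x → suc (m ℕ.+ x)) (sym (∣⊤∣≡n n))) m+|S|≡n))
  ... | e , e∉S with climb m (S [ e ]≔ inside) (trans (cong (m ℕ.+_) (∣S⁺∣ S e e∉S)) (trans (ℕₚ.+-suc m ∣ S ∣) m+|S|≡n))
                   | add S e e∉S
  ... | D , g⁺ , f⁺ | inj₁ (f-grows , g-same) = D , trans (sym g-same) g⁺ , (begin
    f ⊤ ℕ.+ D                       ≡⟨ f⁺ ⟩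
    f (S [ e ]≔ inside) ℕ.+ m       ≡⟨ cong (ℕ._+ m) f-grows ⟩
    suc (f S ℕ.+ m)                 ≡⟨ ℕₚ.+-suc (f S) m ⟨
    f S ℕ.+ suc m                   ∎)
    where open ≡-Reasoning
  ... | D , g⁺ , f⁺ | inj₂ (f-same , g-drops) = suc D , (begin
    g S                             ≡⟨ g-drops ⟨
    suc (g (S [ e ]≔ inside))       ≡⟨ cong suc g⁺ ⟩
    suc (g ⊤ ℕ.+ D)                 ≡⟨ ℕₚ.+-suc (g ⊤) D ⟨
    g ⊤ ℕ.+ suc D                   ∎) , (begin
    f ⊤ ℕ.+ suc D                   ≡⟨ ℕₚ.+-suc (f ⊤) D ⟩
    suc (f ⊤ ℕ.+ D)                 ≡⟨ cong suc (trans f⁺ (cong (ℕ._+ m) f-same)) ⟩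
    suc (f S ℕ.+ m)                 ≡⟨ ℕₚ.+-suc (f S) m ⟨
    f S ℕ.+ suc m                   ∎)
    where open ≡-Reasoning

  exchange : ∀ S → f ⊤ ℕ.+ (g S ∸ g ⊤) ≡ f S ℕ.+ (n ∸ ∣ S ∣)
  exchange S with climb (n ∸ ∣ S ∣) S (ℕₚ.m∸n+n≡m (∣p∣≤n S))
  ... | D , gS , f⊤ = trans (cong (λ x → f ⊤ ℕ.+ (x ∸ g ⊤)) gS) (trans (cong (f ⊤ ℕ.+_) (ℕₚ.m+n∸m≡n (g ⊤) D)) f⊤)

neg-pow : ∀ x b → (- x) ^ b ≡ (- 1ℤ) ^ b * x ^ b
neg-pow x zero    = refl
neg-pow x (suc b) = trans (cong (- x *_) (neg-pow x b)) (regroup x ((- 1ℤ) ^ b) (x ^ b))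
  where
  regroup : ∀ x p q → (- x) * (p * q) ≡ (- 1ℤ) * p * (x * q)
  regroup = solve-∀

-1-pow-square : ∀ b → (- 1ℤ) ^ b * (- 1ℤ) ^ b ≡ 1ℤ
-1-pow-square zero    = refl
-1-pow-square (suc b) = trans (square ((- 1ℤ) ^ b)) (-1-pow-square b)
  where
  square : ∀ p → (- 1ℤ) * p * ((- 1ℤ) * p) ≡ p * p
  square = solve-∀

-- The termwise identity behind R_K(λ) = (-1)^{β_k(K)} T(-1,-λ).
sign-exchange : ∀ (x : ℤ) B D b N → B ℕ.+ D ≡ b ℕ.+ N →
  (- 1ℤ) ^ B * ((- 1ℤ) ^ D * (- x) ^ b) ≡ (- 1ℤ) ^ N * x ^ b
sign-exchange x B D b N B+D≡b+N = begin
  ± B * (± D * (- x) ^ b)         ≡⟨ cong (λ y → ± B * (± D * y)) (neg-pow x b) ⟩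
  ± B * (± D * (± b * x ^ b))     ≡⟨ regroup (± B) (± D) (± b) (x ^ b) ⟩
  (± B * ± D) * ± b * x ^ b       ≡⟨ cong (λ y → y * ± b * x ^ b) (ℤₚ.^-distribˡ-+-* (- 1ℤ) B D) ⟨
  ± (B ℕ.+ D) * ± b * x ^ b       ≡⟨ cong (λ y → ± y * ± b * x ^ b) B+D≡b+N ⟩
  ± (b ℕ.+ N) * ± b * x ^ b       ≡⟨ cong (λ y → y * ± b * x ^ b) (ℤₚ.^-distribˡ-+-* (- 1ℤ) b N) ⟩
  ± b * ± N * ± b * x ^ b         ≡⟨ regroup′ (± b) (± N) (x ^ b) ⟩
  (± b * ± b) * (± N * x ^ b)     ≡⟨ cong (_* (± N * x ^ b)) (-1-pow-square b) ⟩
  1ℤ * (± N * x ^ b)              ≡⟨ ℤₚ.*-identityˡ (± N * x ^ b) ⟩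
  ± N * x ^ b                     ∎
  where
  open ≡-Reasoning
  ± : ℕ → ℤ
  ± m = (- 1ℤ) ^ m
  regroup : ∀ p q r s → p * (q * (r * s)) ≡ p * q * r * s
  regroup = solve-∀
  regroup′ : ∀ p q s → p * q * p * s ≡ p * p * (q * s)
  regroup′ = solve-∀

sumList-factor : ∀ {A : Set} (F G : A → ℤ) (c : ℤ) → (∀ S → F S ≡ c * G S) →
  ∀ xs → sumList (map F xs) ≡ c * sumList (map G xs)
sumList-factor F G c F≡cG List.[]         = sym (ℤₚ.*-zeroʳ c)
sumList-factor F G c F≡cG (x List.∷ xs) =
  trans (cong₂ _+_ (F≡cG x) (sumList-factor F G c F≡cG xs)) (sym (ℤₚ.*-distribˡ-+ c (G x) (sumList (map G xs))))

theorem4p1 : (K : CWComplex) → 1 ≤ CWComplex.dim K →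
    (βk βk-1 : Subset (CWComplex.cells K (CWComplex.dim K)) → ℕ) →
    (∀ S → IsBetti K S (CWComplex.dim K) (βk S)) →
    (∀ S → IsBetti K S (CWComplex.dim K ∸ 1) (βk-1 S)) →
    (λ' : ℤ) →
    Bott K βk λ' ≡ ((- 1ℤ) ^ βk ⊤) * TKR K βk βk-1 (- 1ℤ) (- λ')
theorem4p1 record { dim = zero } ()
theorem4p1 record { dim = suc d ; cells = cells ; bd = bd ; bd∘bd = bd∘bd ; top = top ; above = above }
           _ βk βk-1 isβk isβk-1 λ' =
  sumList-factor _ _ ((- 1ℤ) ^ βk ⊤)
    (λ S → sym (sign-exchange λ' (βk ⊤) (βk-1 S ∸ βk-1 ⊤) (βk S) (n ∸ ∣ S ∣) (exchange S)))
    (allSubsets n)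
  where
  open TopDimension d cells bd bd∘bd top above
  open Exchange βk βk-1 (λ S e e∉S → AddCellBetti.add-cell βk βk-1 isβk isβk-1 S e e∉S)
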